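{- Let $G$ be a simple connected graph with finite multiset dimension. If $v$ is a vertex of $G$ with $|v^*|=2$, then every m-resolving set of $G$ contains exactly one vertex of $v^*$.
   Context: Two vertices $u,v$ are twins if $N(u)\setminus\{v\}=N(v)\setminus\{u\}$. The relation $u\sim v$ iff $u=v$ or $u,v$ are twins is an equivalence relation on $V(G)$; $v^*$ denotes the class of $v$. For $W\subseteq V(G)$, $r_m(v|W)$ is the multiset $\{d(v,w): w\in W\}$ of graph distances; $W$ is an m-resolving set if $r_m(u|W)\neq r_m(v|W)$ for all distinct $u,v$. If $G$ has an m-resolving set, $md(G)$ is the minimum cardinality of one; otherwise $md(G)=\infty$. -}

module Defs where

open import Data.Nat using (ℕ; zero; suc; _≤_)
open import Data.Fin using (Fin)
open import Data.Fin.Subset using (Subset; _∈_; _∉_)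
open import Data.Bool using (Bool; true; false)
open import Data.Product using (Σ; _×_; ∃; proj₁)
open import Data.Sum using (_⊎_)
open import Function.Bundles using (_↔_; _⇔_; Inverse)
open import Relation.Binary.PropositionalEquality using (_≡_; _≢_)
open import Relation.Nullary using (¬_)

record Graph (n : ℕ) : Set where
  field
    adj     : Fin n → Fin n → Bool
    symm    : ∀ u v → adj u v ≡ adj v u
    irrefl  : ∀ v → adj v v ≡ false

module _ {n : ℕ} (G : Graph n) where
  open Graph G

  data Walk : Fin n → Fin n → ℕ → Set where
    here : ∀ {v} → Walk v v zero
    step : ∀ {u w v k} → adj u w ≡ true → Walk w v k → Walk u v (suc k)

  Connected : Set
  Connected = ∀ u v → ∃ λ k → Walk u v k

  Dist : Fin n → Fin n → ℕ → Set
  Dist u v k = Walk u v k × (∀ j → Walk u v j → k ≤ j)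

  -- u and v are twins: N(u) \ {v} = N(v) \ {u}.
  Twins : Fin n → Fin n → Set
  Twins u v = ∀ x → x ≢ u → x ≢ v → adj u x ≡ adj v x

  Elem : Subset n → Set
  Elem W = Σ (Fin n) (λ w → w ∈ W)

  -- r_m(u|W) = r_m(v|W) as multisets: some bijection π of W with
  -- d(u,w) = d(v,π w) for every w ∈ W.
  SameMultiset : Subset n → Fin n → Fin n → Set
  SameMultiset W u v =
    Σ (Elem W ↔ Elem W) λ π →
      ∀ (w : Elem W) k → Dist u (proj₁ w) k ⇔ Dist v (proj₁ (Inverse.to π w)) k

  MResolving : Subset n → Set
  MResolving W = ∀ u v → u ≢ v → ¬ SameMultiset W u v

  FiniteMD : Set
  FiniteMD = ∃ λ W → MResolving W

  -- |v*| = 2 : the twin class of v is exactly {v , u} with u ≠ v.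
  TwinClassIsPair : Fin n → Fin n → Set
  TwinClassIsPair v u =
    u ≢ v × Twins u v × (∀ w → (w ≡ v ⊎ Twins w v) → w ≡ v ⊎ w ≡ u)

module Submission where

-- Twins cannot both lie on the same side of an m-resolving set.
--
-- Let u, v be twins and W any vertex set containing both or neither of
-- them.  The transposition τ = (u v) of the vertex set then maps W onto
-- itself, and it carries distances from u to distances from v:
--   d(u,u) = 0 = d(v,v),   d(u,v) = d(v,u),   d(u,w) = d(v,w) for w ∉ {u,v},
-- the last because a shortest walk leaving u can be rerouted to leave v
-- (twins have the same neighbours outside {u,v}).  Hence τ restricted to W
-- witnesses r_m(u|W) = r_m(v|W), so W does not resolve u ≠ v.

open import Defs
open import Data.Nat using (ℕ; suc; _≤_; z≤n)
open import Data.Nat.Properties using (≤-refl; ≤-trans; ≤-antisym; n≤1+n; n≤0⇒n≡0)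
open import Data.Fin using (Fin; _≟_)
open import Data.Fin.Permutation.Components using (transpose; transpose-inverse)
open import Data.Fin.Subset using (Subset; _∈_; _∉_)
open import Data.Fin.Subset.Properties using (_∈?_)
open import Data.Vec using (here; there)
open import Data.Bool using (true)
open import Data.Product using (_×_; _,_; Σ; ∃)
open import Data.Sum using (_⊎_; inj₁; inj₂)
open import Data.Empty using (⊥-elim)
open import Function using (_∘_; const)
open import Function.Bundles using (_↔_; _⇔_; mk⇔; mk↔ₛ′)
open import Relation.Nullary using (¬_; Dec; yes; no)
open import Relation.Binary.PropositionalEquality

∈-irrelevant : ∀ {n} {W : Subset n} {x : Fin n} (p q : x ∈ W) → p ≡ q
∈-irrelevant here      here      = refl
∈-irrelevant (there p) (there q) = cong there (∈-irrelevant p q)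

subset-element-≡ : ∀ {n} {W : Subset n} {x y : Fin n} →
                   x ≡ y → (p : x ∈ W) (q : y ∈ W) → (x , p) ≡ (y , q)
subset-element-≡ refl p q = cong (_ ,_) (∈-irrelevant p q)

restrict-↔ : ∀ {n} {W : Subset n} (f g : Fin n → Fin n) →
             (∀ {x} → x ∈ W → f x ∈ W) → (∀ {x} → x ∈ W → g x ∈ W) →
             (∀ x → f (g x) ≡ x) → (∀ x → g (f x) ≡ x) →
             Σ (Fin n) (_∈ W) ↔ Σ (Fin n) (_∈ W)
restrict-↔ f g f-pres g-pres fg gf =
  mk↔ₛ′ (λ (x , p) → f x , f-pres p) (λ (x , p) → g x , g-pres p)
        (λ (x , p) → subset-element-≡ (fg x) _ p)
        (λ (x , p) → subset-element-≡ (gf x) _ p)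

transpose-cases : ∀ {n} (i j k : Fin n) →
  (k ≡ i × transpose i j k ≡ j) ⊎ (k ≡ j × transpose i j k ≡ i) ⊎
  (k ≢ i × k ≢ j × transpose i j k ≡ k)
transpose-cases i j k with k ≟ i
... | yes k≡i = inj₁ (k≡i , refl)
... | no k≢i with k ≟ j
...   | yes k≡j = inj₂ (inj₁ (k≡j , refl))
...   | no k≢j  = inj₂ (inj₂ (k≢i , k≢j , refl))

SameSide : ∀ {n} → Subset n → Fin n → Fin n → Set
SameSide W i j = (i ∈ W → j ∈ W) × (j ∈ W → i ∈ W)

transpose-preserves : ∀ {n} {W : Subset n} {i j : Fin n} → SameSide W i j →
                      ∀ {k} → k ∈ W → transpose i j k ∈ W
transpose-preserves {W = W} {i} {j} (i→j , j→i) {k} k∈W with transpose-cases i j k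
... | inj₁ (refl , τk≡j)             = subst (_∈ W) (sym τk≡j) (i→j k∈W)
... | inj₂ (inj₁ (refl , τk≡i))      = subst (_∈ W) (sym τk≡i) (j→i k∈W)
... | inj₂ (inj₂ (_ , _ , τk≡k))     = subst (_∈ W) (sym τk≡k) k∈W

module _ {n : ℕ} (G : Graph n) where
  open Graph G

  adjacent-distinct : ∀ {a x} → adj a x ≡ true → x ≢ a
  adjacent-distinct {a} e refl with trans (sym e) (irrefl a)
  ... | ()

  snoc : ∀ {a b c k} → Walk G a b k → adj b c ≡ true → Walk G a c (suc k)
  snoc here       e = step e here
  snoc (step e p) f = step e (snoc p f)

  reverse : ∀ {a b k} → Walk G a b k → Walk G b a k
  reverse here                   = here
  reverse (step {u = a} {w} e p) = snoc (reverse p) (trans (symm w a) e)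

  dist-sym : ∀ {a b k} → Dist G a b k → Dist G b a k
  dist-sym (p , minimal) = reverse p , λ j q → minimal j (reverse q)

  dist-self-zero : ∀ {a k} → Dist G a a k → k ≡ 0
  dist-self-zero (_ , minimal) = n≤0⇒n≡0 (minimal 0 here)

  dist-self : ∀ {a} → Dist G a a 0
  dist-self = here , λ _ _ → z≤n

  dist-self-transfer : ∀ {a b k} → Dist G a a k → Dist G b b k
  dist-self-transfer d = subst (Dist G _ _) (sym (dist-self-zero d)) dist-self

  twins-sym : ∀ {a b} → Twins G a b → Twins G b a
  twins-sym tw x x≢b x≢a = sym (tw x x≢a x≢b)

  -- Rerouting: a walk from a to w ∉ {a} starts with an edge a–x; if x = b
  -- its tail already starts at b, otherwise b is adjacent to x as well.
  twin-reroute : ∀ {a b w j} → Twins G a b → w ≢ a → Walk G a w j →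
                 ∃ λ i → Walk G b w i × i ≤ j
  twin-reroute _  w≢a here = ⊥-elim (w≢a refl)
  twin-reroute {b = b} tw _ (step {w = x} {k = k} e p) with x ≟ b
  ... | yes refl = k , p , n≤1+n k
  ... | no x≢b   = suc k , step (trans (sym (tw x (adjacent-distinct e) x≢b)) e) p , ≤-refl

  twin-dist : ∀ {a b w k} → Twins G a b → w ≢ a → w ≢ b → Dist G a w k → Dist G b w k
  twin-dist {a} {b} {w} {k} tw w≢a w≢b (p , minimal) with twin-reroute tw w≢a p
  ... | i , q , i≤k = subst (Walk G b w) (≤-antisym i≤k (minimal-from-b i q)) q , minimal-from-b
    where
    minimal-from-b : ∀ j → Walk G b w j → k ≤ j
    minimal-from-b j r with twin-reroute (twins-sym tw) w≢b r
    ... | j′ , r′ , j′≤j = ≤-trans (minimal j′ r′) j′≤j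

  transpose-dist : ∀ {a b} → Twins G a b → ∀ x k → Dist G a x k ⇔ Dist G b (transpose a b x) k
  transpose-dist {a} {b} tw x k with transpose-cases a b x
  ... | inj₁ (refl , τx≡b) rewrite τx≡b = mk⇔ dist-self-transfer dist-self-transfer
  ... | inj₂ (inj₁ (refl , τx≡a)) rewrite τx≡a = mk⇔ dist-sym dist-sym
  ... | inj₂ (inj₂ (x≢a , x≢b , τx≡x)) rewrite τx≡x =
    mk⇔ (twin-dist tw x≢a x≢b) (twin-dist (twins-sym tw) x≢b x≢a)

  twins-same-multiset : ∀ {W a b} → Twins G a b → SameSide W a b → SameMultiset G W a b
  twins-same-multiset {a = a} {b} tw (a→b , b→a) =
    restrict-↔ (transpose a b) (transpose b a)
               (transpose-preserves (a→b , b→a)) (transpose-preserves (b→a , a→b))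
               (λ _ → transpose-inverse a b) (λ _ → transpose-inverse b a) ,
    λ (x , _) → transpose-dist tw x

  resolving-separates-twins : ∀ {W a b} → MResolving G W → a ≢ b → Twins G a b →
                              ¬ SameSide W a b
  resolving-separates-twins resolving a≢b tw same =
    resolving _ _ a≢b (twins-same-multiset tw same)

-- Lemma 3.6: with v* = {v, u}, every m-resolving set W contains exactly one
-- of u and v.
lemma3p6 : ∀ {n : ℕ} (G : Graph n) → Connected G → FiniteMD G →
           (v u : Fin n) → TwinClassIsPair G v u →
           ∀ (W : Subset n) → MResolving G W →
           (u ∈ W × v ∉ W) ⊎ (v ∈ W × u ∉ W)
lemma3p6 G _ _ v u (u≢v , twins , _) W resolving = exactly-one (u ∈? W) (v ∈? W)
  where
  not-same-side : ¬ SameSide W u v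
  not-same-side = resolving-separates-twins G resolving u≢v twins

  exactly-one : Dec (u ∈ W) → Dec (v ∈ W) → (u ∈ W × v ∉ W) ⊎ (v ∈ W × u ∉ W)
  exactly-one (yes u∈W) (no v∉W)  = inj₁ (u∈W , v∉W)
  exactly-one (no u∉W)  (yes v∈W) = inj₂ (v∈W , u∉W)
  exactly-one (yes u∈W) (yes v∈W) = ⊥-elim (not-same-side (const v∈W , const u∈W))
  exactly-one (no u∉W)  (no v∉W)  = ⊥-elim (not-same-side (⊥-elim ∘ u∉W , ⊥-elim ∘ v∉W))
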